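{- Let $t,a$ be positive integers. Then $W(t)\leq c_{t,a}\,t^{1/a}$, where $c_{t,a}=2^s/(p_1\cdots p_s)^{1/a}$ and $p_1,\dots,p_s$ are the distinct primes $\leq 2^a$ dividing $t$. In particular, setting $c_t:=c_{t,4}$ and $d_t:=c_{t,8}$, for every positive integer $t$ one has $c_t<4.9$ and $d_t<4514.7$.
   Context: $W(t)$ denotes the number of square-free positive divisors of $t$, i.e. $2^{\omega(t)}$ where $\omega(t)$ is the number of distinct prime divisors of $t$. -}

module Defs where

open import Data.Nat using (ℕ; _^_; _*_)
open import Data.Nat.Divisibility using (_∣_; _∣?_)
open import Data.Nat.Primality using (Prime; prime?)
open import Data.List using (List; filter; upTo; length)
open import Data.Nat.ListAction using (product)
open import Data.Product using (_×_)
open import Relation.Nullary.Decidable using (_×-dec_)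

primeDivisorsUpTo : ℕ → ℕ → List ℕ
primeDivisorsUpTo B t = filter (λ p → prime? p ×-dec (p ∣? t)) (upTo (ℕ.suc B))

-- ω(t): number of distinct prime divisors of t (for t ≥ 1 all are ≤ t)
ω : ℕ → ℕ
ω t = length (primeDivisorsUpTo t t)

-- W(t) = 2^ω(t), the number of square-free divisors of t
W : ℕ → ℕ
W t = 2 ^ ω t

s : ℕ → ℕ → ℕ
s t a = length (primeDivisorsUpTo (2 ^ a) t)

P : ℕ → ℕ → ℕ
P t a = product (primeDivisorsUpTo (2 ^ a) t)

module Submission where

-- Write pd(B, t) for the increasing list of primes p ≤ B dividing t, so that
-- ω(t) = |pd(t, t)|, s = |pd(2^a, t)| and P = ∏ pd(2^a, t).
--
-- Both halves of the theorem rest on one elementary comparison (the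
-- "filter weight" lemmas): if a list xs is filtered by a predicate Q, every
-- discarded element x contributes the factor x to ∏ xs and the factor B to
-- B^|xs|; so ∏ and B^|·| move in opposite directions according to whether the
-- discarded elements are ≥ B or ≤ B.
--
-- 1. pd(N, t) is a list of distinct primes dividing t, hence ∏ pd(N, t) ∣ t;
--    it stops growing once N ≥ t, and truncating it at B gives pd(B, t).
--    Applying the "≥ B" weight lemma to pd(B + t, t), truncated at B, yields
--    B^ω(t) · ∏ pd(B, t) ≤ B^|pd(B, t)| · t; with B = 2^a this is the bound
--    W(t)^a · P ≤ 2^(s a) · t.
-- 2. pd(B, t) is the set of primes ≤ B filtered by divisibility by t, so the
--    "≤ B" weight lemma reduces the bounds on c_t and d_t to the single case
--    where t is divisible by all primes ≤ 2^a, which is checked by computation.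

open import Defs
open import Data.Nat
  using (ℕ; zero; suc; _+_; _*_; _^_; _≤_; _<_; _≤?_; s≤s; s≤s⁻¹; NonZero; >-nonZero)
open import Data.Nat.Properties
open import Data.Nat.Divisibility using (_∣_; _∣?_; divides; ∣⇒≤; 1∣_)
open import Data.Nat.Coprimality using (Coprime; coprime-divisor)
open import Data.Nat.Primality using (Prime; prime?; prime⇒irreducible; productOfPrimes≢0)
open import Data.Nat.Primality.Factorisation using (factorisationHasAllPrimeFactors)
open import Data.Nat.ListAction using (product)
open import Data.List using (List; []; _∷_; [_]; _++_; filter; upTo; length)
open import Data.List.Properties using (filter-++; filter-all; filter-none; upTo-∷ʳ; ++-identityʳ)
open import Data.List.Relation.Unary.All as All using (All; []; _∷_)
open import Data.List.Relation.Unary.All.Properties as AllProp using (all-filter; all-upTo)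
open import Data.List.Relation.Unary.AllPairs using (_∷_)
open import Data.List.Relation.Unary.Unique.Propositional using (Unique)
open import Data.List.Relation.Unary.Unique.Propositional.Properties as UniqueProp using (upTo⁺)
open import Data.Bool using (true; false)
open import Data.Product using (_×_; _,_; proj₁; proj₂)
open import Data.Sum using (inj₁; inj₂)
open import Data.Unit using (tt)
open import Function using (_∘_)
open import Relation.Nullary using (¬_; yes; no; does; contradiction)
open import Relation.Nullary.Decidable using (_×-dec_)
open import Relation.Unary using (Pred; Decidable)
open import Relation.Binary.PropositionalEquality
  using (_≡_; refl; sym; trans; cong; cong₂; subst; module ≡-Reasoning)
open import Algebra.Properties.CommutativeSemigroup *-commutativeSemigroup using (x∙yz≈y∙xz; xy∙z≈xz∙y)

-- Filtering out elements that are all ≥ B: each loses a factor of at least B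
-- from the product, and exactly B from the power of B.
filter-weight-≥ : ∀ {ℓ} {Q : Pred ℕ ℓ} (Q? : Decidable Q) B xs →
                  All (λ x → ¬ Q x → B ≤ x) xs →
                  B ^ length xs * product (filter Q? xs)
                    ≤ B ^ length (filter Q? xs) * product xs
filter-weight-≥ Q? B [] [] = ≤-refl
filter-weight-≥ Q? B (x ∷ xs) (big ∷ bigs) with Q? x
... | yes _ = begin
  (B * B ^ length xs) * (x * product (filter Q? xs))
    ≡⟨ [m*n]*[o*p]≡[m*o]*[n*p] B _ x _ ⟩
  (B * x) * (B ^ length xs * product (filter Q? xs))
    ≤⟨ *-monoʳ-≤ (B * x) (filter-weight-≥ Q? B xs bigs) ⟩
  (B * x) * (B ^ length (filter Q? xs) * product xs)
    ≡⟨ [m*n]*[o*p]≡[m*o]*[n*p] B x _ _ ⟩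
  (B * B ^ length (filter Q? xs)) * (x * product xs) ∎
  where open ≤-Reasoning
... | no ¬Qx = begin
  (B * B ^ length xs) * product (filter Q? xs)
    ≡⟨ *-assoc B _ _ ⟩
  B * (B ^ length xs * product (filter Q? xs))
    ≤⟨ *-mono-≤ (big ¬Qx) (filter-weight-≥ Q? B xs bigs) ⟩
  x * (B ^ length (filter Q? xs) * product xs)
    ≡⟨ x∙yz≈y∙xz x (B ^ length (filter Q? xs)) (product xs) ⟩
  B ^ length (filter Q? xs) * (x * product xs) ∎
  where open ≤-Reasoning

filter-weight-≤ : ∀ {ℓ} {Q : Pred ℕ ℓ} (Q? : Decidable Q) B xs →
                  All (λ x → ¬ Q x → x ≤ B) xs →
                  B ^ length (filter Q? xs) * product xs
                    ≤ B ^ length xs * product (filter Q? xs)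
filter-weight-≤ Q? B [] [] = ≤-refl
filter-weight-≤ Q? B (x ∷ xs) (small ∷ smalls) with Q? x
... | yes _ = begin
  (B * B ^ length (filter Q? xs)) * (x * product xs)
    ≡⟨ [m*n]*[o*p]≡[m*o]*[n*p] B _ x _ ⟩
  (B * x) * (B ^ length (filter Q? xs) * product xs)
    ≤⟨ *-monoʳ-≤ (B * x) (filter-weight-≤ Q? B xs smalls) ⟩
  (B * x) * (B ^ length xs * product (filter Q? xs))
    ≡⟨ [m*n]*[o*p]≡[m*o]*[n*p] B x _ _ ⟩
  (B * B ^ length xs) * (x * product (filter Q? xs)) ∎
  where open ≤-Reasoning
... | no ¬Qx = begin
  B ^ length (filter Q? xs) * (x * product xs)
    ≡⟨ x∙yz≈y∙xz (B ^ length (filter Q? xs)) x (product xs) ⟩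
  x * (B ^ length (filter Q? xs) * product xs)
    ≤⟨ *-mono-≤ (small ¬Qx) (filter-weight-≤ Q? B xs smalls) ⟩
  B * (B ^ length xs * product (filter Q? xs))
    ≡⟨ *-assoc B _ _ ⟨
  (B * B ^ length xs) * product (filter Q? xs) ∎
  where open ≤-Reasoning

prime∤⇒coprime : ∀ {p n} → Prime p → ¬ p ∣ n → Coprime p n
prime∤⇒coprime p-prime p∤n (d∣p , d∣n) with prime⇒irreducible p-prime d∣p
... | inj₁ d≡1 = d≡1
... | inj₂ refl = contradiction d∣n p∤n

coprime-∣⇒*∣ : ∀ {m n t} → Coprime m n → m ∣ t → n ∣ t → m * n ∣ t
coprime-∣⇒*∣ {m} {n} {t} coprime m∣t (divides q t≡q*n)
  with coprime-divisor coprime (subst (m ∣_) (trans t≡q*n (*-comm q n)) m∣t)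
... | divides r q≡r*m = divides r (begin
  t           ≡⟨ t≡q*n ⟩
  q * n       ≡⟨ cong (_* n) q≡r*m ⟩
  r * m * n   ≡⟨ *-assoc r m n ⟩
  r * (m * n) ∎)
  where open ≡-Reasoning

distinct-primes-∣ : ∀ {t} xs → All Prime xs → Unique xs → All (_∣ t) xs →
                    product xs ∣ t
distinct-primes-∣ [] _ _ _ = 1∣ _
distinct-primes-∣ (x ∷ xs) (x-prime ∷ xs-prime) (x∉xs ∷ xs-unique) (x∣t ∷ xs∣t) =
  coprime-∣⇒*∣ (prime∤⇒coprime x-prime x∤∏xs) x∣t
               (distinct-primes-∣ xs xs-prime xs-unique xs∣t)
  where
  -- a prime dividing a product of primes is one of them
  x∤∏xs : ¬ x ∣ product xs
  x∤∏xs x∣∏xs =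
    All.lookup x∉xs (factorisationHasAllPrimeFactors x-prime x∣∏xs xs-prime) refl

primeDivisor? : ∀ t → Decidable (λ p → Prime p × p ∣ t)
primeDivisor? t p = prime? p ×-dec (p ∣? t)

primeDivisorsUpTo-∣ : ∀ B t → product (primeDivisorsUpTo B t) ∣ t
primeDivisorsUpTo-∣ B t =
  distinct-primes-∣ _ (All.map proj₁ prime-divisors)
    (UniqueProp.filter⁺ (primeDivisor? t) (upTo⁺ (suc B)))
    (All.map proj₂ prime-divisors)
  where
  prime-divisors = all-filter (primeDivisor? t) (upTo (suc B))

primeDivisorsUpTo-suc : ∀ B t → primeDivisorsUpTo (suc B) t
                          ≡ primeDivisorsUpTo B t ++ filter (primeDivisor? t) [ suc B ]
primeDivisorsUpTo-suc B t = begin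
  filter (primeDivisor? t) (upTo (suc (suc B)))
    ≡⟨ cong (filter (primeDivisor? t)) (upTo-∷ʳ (suc B)) ⟨
  filter (primeDivisor? t) (upTo (suc B) ++ [ suc B ])
    ≡⟨ filter-++ (primeDivisor? t) (upTo (suc B)) [ suc B ] ⟩
  primeDivisorsUpTo B t ++ filter (primeDivisor? t) [ suc B ] ∎
  where open ≡-Reasoning

-- pd(N, t) stops growing at N = t, since no number above t divides t ≠ 0.
primeDivisorsUpTo-stable : ∀ t .{{_ : NonZero t}} k →
                           primeDivisorsUpTo (k + t) t ≡ primeDivisorsUpTo t t
primeDivisorsUpTo-stable t zero = refl
primeDivisorsUpTo-stable t (suc k) = begin
  primeDivisorsUpTo (suc (k + t)) t
    ≡⟨ primeDivisorsUpTo-suc (k + t) t ⟩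
  primeDivisorsUpTo (k + t) t ++ filter (primeDivisor? t) [ suc (k + t) ]
    ≡⟨ cong (primeDivisorsUpTo (k + t) t ++_) (filter-none (primeDivisor? t) (too-big ∷ [])) ⟩
  primeDivisorsUpTo (k + t) t ++ []
    ≡⟨ ++-identityʳ _ ⟩
  primeDivisorsUpTo (k + t) t
    ≡⟨ primeDivisorsUpTo-stable t k ⟩
  primeDivisorsUpTo t t ∎
  where
  open ≡-Reasoning
  too-big : ¬ (Prime (suc (k + t)) × suc (k + t) ∣ t)
  too-big (_ , divides-t) = <⇒≱ (s≤s (m≤n+m t k)) (∣⇒≤ divides-t)

primeDivisorsUpTo-truncate : ∀ B t k →
  filter (_≤? B) (primeDivisorsUpTo (k + B) t) ≡ primeDivisorsUpTo B t
primeDivisorsUpTo-truncate B t zero =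
  filter-all (_≤? B) (AllProp.filter⁺ (primeDivisor? t) (All.map s≤s⁻¹ (all-upTo (suc B))))
primeDivisorsUpTo-truncate B t (suc k) = begin
  filter (_≤? B) (primeDivisorsUpTo (suc (k + B)) t)
    ≡⟨ cong (filter (_≤? B)) (primeDivisorsUpTo-suc (k + B) t) ⟩
  filter (_≤? B) (primeDivisorsUpTo (k + B) t ++ new)
    ≡⟨ filter-++ (_≤? B) (primeDivisorsUpTo (k + B) t) new ⟩
  filter (_≤? B) (primeDivisorsUpTo (k + B) t) ++ filter (_≤? B) new
    ≡⟨ cong₂ _++_ (primeDivisorsUpTo-truncate B t k)
                  (filter-none (_≤? B) (AllProp.filter⁺ (primeDivisor? t) (above-B ∷ []))) ⟩
  primeDivisorsUpTo B t ++ []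
    ≡⟨ ++-identityʳ _ ⟩
  primeDivisorsUpTo B t ∎
  where
  open ≡-Reasoning
  new = filter (primeDivisor? t) [ suc (k + B) ]
  above-B : ¬ suc (k + B) ≤ B
  above-B = <⇒≱ (s≤s (m≤n+m B k))

-- First half of the theorem for an arbitrary bound B in place of 2^a: primes
-- above B are ≥ B, and all prime divisors together multiply to at most t.
primeDivisors-bound : ∀ t .{{_ : NonZero t}} B →
  B ^ ω t * product (primeDivisorsUpTo B t) ≤ B ^ length (primeDivisorsUpTo B t) * t
primeDivisors-bound t B = begin
  B ^ ω t * product (primeDivisorsUpTo B t)
    ≡⟨ cong₂ (λ xs ys → B ^ length xs * product ys)
             (sym (primeDivisorsUpTo-stable t B)) (sym small≡) ⟩
  B ^ length ds * product (filter (_≤? B) ds)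
    ≤⟨ filter-weight-≥ (_≤? B) B ds (All.universal (λ _ → <⇒≤ ∘ ≰⇒>) ds) ⟩
  B ^ length (filter (_≤? B) ds) * product ds
    ≤⟨ *-monoʳ-≤ (B ^ length (filter (_≤? B) ds)) (∣⇒≤ (primeDivisorsUpTo-∣ (B + t) t)) ⟩
  B ^ length (filter (_≤? B) ds) * t
    ≡⟨ cong (λ xs → B ^ length xs * t) small≡ ⟩
  B ^ length (primeDivisorsUpTo B t) * t ∎
  where
  open ≤-Reasoning
  -- all prime divisors of t, listed up to a bound exceeding both t and B
  ds = primeDivisorsUpTo (B + t) t
  small≡ : filter (_≤? B) ds ≡ primeDivisorsUpTo B t
  small≡ = trans (cong (λ n → filter (_≤? B) (primeDivisorsUpTo n t)) (+-comm B t))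
                 (primeDivisorsUpTo-truncate B t t)

filter-×-dec : ∀ {a ℓ₁ ℓ₂} {A : Set a} {P : Pred A ℓ₁} {R : Pred A ℓ₂}
               (P? : Decidable P) (R? : Decidable R) xs →
               filter (λ x → P? x ×-dec R? x) xs ≡ filter R? (filter P? xs)
filter-×-dec P? R? [] = refl
filter-×-dec P? R? (x ∷ xs) with does (P? x)
... | false = filter-×-dec P? R? xs
... | true with does (R? x)
...   | true  = cong (x ∷_) (filter-×-dec P? R? xs)
...   | false = filter-×-dec P? R? xs

primesUpTo : ℕ → List ℕ
primesUpTo B = filter prime? (upTo (suc B))

worst-case-bound : ∀ B K C →
  B ^ length (primesUpTo B) * K < C * product (primesUpTo B) →
  ∀ t → B ^ length (primeDivisorsUpTo B t) * K < C * product (primeDivisorsUpTo B t)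
worst-case-bound B K C all-primes t
  rewrite filter-×-dec prime? (_∣? t) (upTo (suc B)) =
  *-cancelʳ-< ∏ps (B ^ length ds * K) (C * ∏ds) (begin-strict
    B ^ length ds * K * ∏ps   ≡⟨ xy∙z≈xz∙y (B ^ length ds) K ∏ps ⟩
    B ^ length ds * ∏ps * K   ≤⟨ *-monoˡ-≤ K (filter-weight-≤ (_∣? t) B ps small) ⟩
    B ^ length ps * ∏ds * K   ≡⟨ xy∙z≈xz∙y (B ^ length ps) ∏ds K ⟩
    B ^ length ps * K * ∏ds   <⟨ *-monoˡ-< ∏ds all-primes ⟩
    C * ∏ps * ∏ds             ≡⟨ xy∙z≈xz∙y C ∏ps ∏ds ⟩
    C * ∏ds * ∏ps             ∎)
  where
  open ≤-Reasoning
  ps = primesUpTo B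
  ds = filter (_∣? t) ps
  ∏ps = product ps
  ∏ds = product ds
  instance
    ∏ds≢0 : NonZero ∏ds
    ∏ds≢0 = productOfPrimes≢0 (AllProp.filter⁺ (_∣? t) (all-filter prime? (upTo (suc B))))
  small : All (λ p → ¬ p ∣ t → p ≤ B) ps
  small = AllProp.filter⁺ prime? (All.map (λ p<1+B _ → s≤s⁻¹ p<1+B) (all-upTo (suc B)))

^-*-comm : ∀ m n a → m ^ (n * a) ≡ (m ^ a) ^ n
^-*-comm m n a = trans (cong (m ^_) (*-comm n a)) (sym (^-*-assoc m a n))

^-swap : ∀ m n a → (m ^ n) ^ a ≡ (m ^ a) ^ n
^-swap m n a = trans (^-*-assoc m n a) (^-*-comm m n a)

-- The worst cases a = 4 and a = 8, checked by evaluation: with all primes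
-- ≤ 2^a present, 2^(a s) / P is below 4.9 resp. 4514.7 raised to the power a.
all-primes-4 : (2 ^ 4) ^ length (primesUpTo (2 ^ 4)) * 10 ^ 4 < 49 ^ 4 * product (primesUpTo (2 ^ 4))
all-primes-4 = ≤ᵇ⇒≤ _ _ tt

all-primes-8 : (2 ^ 8) ^ length (primesUpTo (2 ^ 8)) * 10 ^ 8 < 45147 ^ 8 * product (primesUpTo (2 ^ 8))
all-primes-8 = ≤ᵇ⇒≤ _ _ tt

lemma5 : ((t a : ℕ) → 1 ≤ t → 1 ≤ a → W t ^ a * P t a ≤ 2 ^ (s t a * a) * t)
    × ((t : ℕ) → 1 ≤ t → 2 ^ (s t 4 * 4) * 10 ^ 4 < 49 ^ 4 * P t 4)
    × ((t : ℕ) → 1 ≤ t → 2 ^ (s t 8 * 8) * 10 ^ 8 < 45147 ^ 8 * P t 8)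
lemma5 = W-bound , c-bound , d-bound
  where

  W-bound : (t a : ℕ) → 1 ≤ t → 1 ≤ a → W t ^ a * P t a ≤ 2 ^ (s t a * a) * t
  W-bound t a 1≤t _ = begin
    W t ^ a * P t a          ≡⟨ cong (_* P t a) (^-swap 2 (ω t) a) ⟩
    (2 ^ a) ^ ω t * P t a    ≤⟨ primeDivisors-bound t (2 ^ a) ⟩
    (2 ^ a) ^ s t a * t      ≡⟨ cong (_* t) (^-*-comm 2 (s t a) a) ⟨
    2 ^ (s t a * a) * t      ∎
    where
    open ≤-Reasoning
    instance _ = >-nonZero 1≤t

  c-bound : (t : ℕ) → 1 ≤ t → 2 ^ (s t 4 * 4) * 10 ^ 4 < 49 ^ 4 * P t 4
  c-bound t _ = subst (λ x → x * 10 ^ 4 < 49 ^ 4 * P t 4) (sym (^-*-comm 2 (s t 4) 4))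
    (worst-case-bound (2 ^ 4) (10 ^ 4) (49 ^ 4) all-primes-4 t)

  d-bound : (t : ℕ) → 1 ≤ t → 2 ^ (s t 8 * 8) * 10 ^ 8 < 45147 ^ 8 * P t 8
  d-bound t _ = subst (λ x → x * 10 ^ 8 < 45147 ^ 8 * P t 8) (sym (^-*-comm 2 (s t 8) 8))
    (worst-case-bound (2 ^ 8) (10 ^ 8) (45147 ^ 8) all-primes-8 t)
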